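{- For every permutation $\sigma\in S_n$, we have $|s^{ -1}(\sigma)|\leq|s^{ -1}(s(\sigma))|$, and equality holds if and only if $\sigma=123\cdots n$.
   Context: $S_n$ is the set of permutations of $[n]$ in one-line notation. West's stack-sorting map $s$ is defined recursively: $s$ sends the empty permutation to itself, and if $\pi=LmR$ is nonempty with $m$ its largest entry, then $s(\pi)=s(L)\,s(R)\,m$. Here $s^{ -1}(\sigma)=\{\tau\in S_n: s(\tau)=\sigma\}$, and $|s^{ -1}(\sigma)|$ is called the fertility of $\sigma$. -}

module Defs where

open import Data.Nat using (ℕ; zero; suc; _⊔_)
open import Data.Nat.Properties using (_≟_)
open import Data.List using (List; []; _∷_; _++_; length; concatMap; map; filter; upTo)
open import Data.Product using (_×_; _,_)
open import Data.Bool using (Bool; true; false)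
open import Relation.Nullary.Decidable using (does)
open import Relation.Binary.PropositionalEquality using (_≡_)
open import Data.List.Relation.Binary.Permutation.Propositional using (_↭_)

idPerm : ℕ → List ℕ
idPerm n = map suc (upTo n)

-- S n : permutations of [n] in one-line notation
S : ℕ → List ℕ → Set
S n π = π ↭ idPerm n

-- largest entry of a list (0 for the empty list; entries are ≥ 1)
maxL : List ℕ → ℕ
maxL [] = 0
maxL (x ∷ xs) = x ⊔ maxL xs

splitAt : ℕ → List ℕ → List ℕ × List ℕ
splitAt m [] = [] , []
splitAt m (x ∷ xs) with does (x ≟ m)
... | true  = [] , xs
... | false with splitAt m xs
...   | (L , R) = x ∷ L , R

-- West's stack-sorting map, s(LmR) = s(L) s(R) m ; fuel = length suffices
sFuel : ℕ → List ℕ → List ℕ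
sFuel zero π = π
sFuel (suc k) [] = []
sFuel (suc k) π@(_ ∷ _) with splitAt (maxL π) π
... | (L , R) = sFuel k L ++ sFuel k R ++ (maxL π ∷ [])

s : List ℕ → List ℕ
s π = sFuel (length π) π

insertions : ℕ → List ℕ → List (List ℕ)
insertions x [] = (x ∷ []) ∷ []
insertions x (y ∷ ys) = (x ∷ y ∷ ys) ∷ map (y ∷_) (insertions x ys)

-- all permutations of a list (each exactly once when entries are distinct)
perms : List ℕ → List (List ℕ)
perms [] = [] ∷ []
perms (x ∷ xs) = concatMap (insertions x) (perms xs)



fertility : ℕ → List ℕ → ℕ
fertility n σ = length (filter (λ τ → listEq (s τ) σ) (perms (idPerm n)))
  where
  open import Data.List.Properties using (≡-dec)
  listEq = ≡-dec _≟_

module Submission where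

-- Write g(w) for the number of s-preimages of a word w with distinct entries.
-- Since s(L m R) = s(L) s(R) m when m is the maximum, g satisfies the
-- fertility recursion  g [] = 1,  g (I ++ [m]) = Σ_{I = A B} g A · g B  if every
-- entry of I is below m, and 0 otherwise.  Let Fⱼ = g ⋆ ⋯ ⋆ g be the j-fold
-- convolution power of g over cuts of words (so F₁ = g).  The recursion
-- yields a splitting formula for Fⱼ (L m R) in terms of the F's of L and R,
-- and a superadditivity estimate bounds such sums by the F's of L ++ R.
-- Strong induction on π = L m R then shows Fⱼ π ≤ Fⱼ (s π) for every j,
-- strictly for j ≥ 1 when s π ≠ π; j = 1 is the inequality of the theorem.

open import Defs
open import Data.Nat using (ℕ; zero; suc; _+_; _*_; _≤_; _<_; _<?_; _≡ᵇ_; z≤n; s≤s)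
open import Data.Bool using (true; false; T)
open import Data.Unit using (tt)
open import Data.Nat.Properties
open import Data.Nat.Tactic.RingSolver using (solve-∀)
open import Data.List using (List; []; _∷_; _++_; length; map; concatMap; filter; upTo)
open import Data.List.Properties
  using (length-++; ++-assoc; ∷-injective; ∷-injectiveʳ; ++-cancelˡ; length-map; ≡-dec;
         map-++; upTo-∷ʳ; ∷ʳ-injective; ++-identityʳ; length-upTo)
open import Data.List.Relation.Unary.All as All using (All; []; _∷_; all?)
import Data.List.Relation.Unary.All.Properties as AllP
open import Data.List.Relation.Unary.Any as Any using (Any; here; there)
open import Data.List.Relation.Unary.AllPairs using ([]; _∷_)
open import Data.List.Relation.Unary.Unique.Propositional using (Unique)
import Data.List.Relation.Unary.Unique.Propositional.Properties as Unique
open import Data.List.Membership.Propositional using (_∈_; _∉_; find)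
open import Data.List.Membership.Propositional.Properties
open import Data.List.Membership.Propositional.Properties.WithK using (unique∧set⇒bag)
open import Data.List.Relation.Binary.BagAndSetEquality using (∼bag⇒↭)
open import Data.List.Relation.Binary.Permutation.Propositional
  using (_↭_; ↭-refl; ↭-sym; ↭-trans; ↭-reflexive; prep; ↭⇒↭ₛ)
open import Data.List.Relation.Binary.Permutation.Propositional.Properties
  using (All-resp-↭; ∈-resp-↭; shift; ∷↭∷ʳ; ++⁺; ++⁺ˡ; ↭-length; drop-mid; ↭-empty-inv)
import Data.List.Relation.Binary.Permutation.Setoid.Properties as Perm
open import Data.Product using (∃; ∃₂; _×_; _,_; proj₁; proj₂; map₁)
open import Data.Sum using (inj₁; inj₂)
open import Data.Empty using (⊥-elim)
open import Relation.Nullary using (¬_; Dec; yes; no)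
open import Relation.Binary.PropositionalEquality
open import Function.Base using (_∘_)
open import Function.Bundles using (_⇔_; mk⇔)

-- 1. Lists without repetitions and sums over the cuts of a list.

module _ {A : Set} where

  Unique-resp-↭ : {xs ys : List A} → xs ↭ ys → Unique xs → Unique ys
  Unique-resp-↭ p = Perm.Unique-resp-↭ (setoid A) (↭⇒↭ₛ p)

  -- Two duplicate-free lists with the same members have the same length;
  -- this is how the fertility (a filtered count) is identified with the
  -- length of our enumeration of preimages.
  unique-length : {xs ys : List A} → Unique xs → Unique ys →
    (∀ {z} → z ∈ xs → z ∈ ys) → (∀ {z} → z ∈ ys → z ∈ xs) → length xs ≡ length ys
  unique-length ux uy to from = ↭-length (∼bag⇒↭ (unique∧set⇒bag ux uy (mk⇔ to from)))

  unique-++ˡ : ∀ xs {ys : List A} → Unique (xs ++ ys) → Unique xs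
  unique-++ˡ [] u = []
  unique-++ˡ (x ∷ xs) (x∉ ∷ u) = AllP.++⁻ˡ xs x∉ ∷ unique-++ˡ xs u

  unique-++ʳ : ∀ xs {ys : List A} → Unique (xs ++ ys) → Unique ys
  unique-++ʳ [] u = u
  unique-++ʳ (x ∷ xs) (_ ∷ u) = unique-++ʳ xs u

  unique-around : ∀ L {m : A} {R} → Unique (L ++ m ∷ R) → Unique L × Unique R
  unique-around L u with unique-++ʳ L u
  ... | _ ∷ uR = unique-++ˡ L u , uR

  unique-head : {x : A} {xs : List A} → Unique (x ∷ xs) → x ∉ xs
  unique-head = Unique.Unique[x∷xs]⇒x∉xs

  cut-unique : (P P′ : List A) {x : A} {Q Q′ : List A} → x ∉ P → x ∉ P′ →
    P ++ x ∷ Q ≡ P′ ++ x ∷ Q′ → P ≡ P′ × Q ≡ Q′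
  cut-unique [] [] _ _ refl = refl , refl
  cut-unique [] (_ ∷ _) _ x∉P′ refl = ⊥-elim (x∉P′ (here refl))
  cut-unique (_ ∷ _) [] x∉P _ refl = ⊥-elim (x∉P (here refl))
  cut-unique (p ∷ P) (_ ∷ P′) x∉P x∉P′ eq with ∷-injective eq
  ... | refl , eq′ with cut-unique P P′ (x∉P ∘ there) (x∉P′ ∘ there) eq′
  ... | refl , refl = refl , refl

module _ {A B : Set} where

  unique-concatMap : (f : A → List B) (xs : List A) → Unique xs →
    (∀ {x} → x ∈ xs → Unique (f x)) →
    (∀ {x y z} → x ∈ xs → y ∈ xs → z ∈ f x → z ∈ f y → x ≡ y) → Unique (concatMap f xs)
  unique-concatMap f [] _ _ _ = []
  unique-concatMap f (x ∷ xs) (x∉ ∷ u) uf disj =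
    Unique.++⁺ (uf (here refl))
      (unique-concatMap f xs u (uf ∘ there) (λ p q → disj (there p) (there q)))
      (λ (z∈fx , z∈rest) →
        let (y , y∈xs , z∈fy) = find (∈-concatMap⁻ f {xs = xs} z∈rest)
        in All.lookup x∉ y∈xs (disj (here refl) (there y∈xs) z∈fx z∈fy))

-- Sums over the |w| + 1 cuts of a word w into a prefix and a suffix:
--   Σcuts h w = Σ_{P ++ Q = w} h P Q.
module _ {A : Set} where

  Σcuts : (List A → List A → ℕ) → List A → ℕ
  Σcuts h [] = h [] []
  Σcuts h (x ∷ xs) = h [] (x ∷ xs) + Σcuts (λ P Q → h (x ∷ P) Q) xs

  Σcuts-cong : ∀ {h h′ : List A → List A → ℕ} w →
    (∀ P Q → P ++ Q ≡ w → h P Q ≡ h′ P Q) → Σcuts h w ≡ Σcuts h′ w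
  Σcuts-cong [] e = e [] [] refl
  Σcuts-cong (x ∷ w) e =
    cong₂ _+_ (e [] (x ∷ w) refl) (Σcuts-cong w (λ P Q eq → e (x ∷ P) Q (cong (x ∷_) eq)))

  Σcuts-mono : ∀ {h h′ : List A → List A → ℕ} w →
    (∀ P Q → P ++ Q ≡ w → h P Q ≤ h′ P Q) → Σcuts h w ≤ Σcuts h′ w
  Σcuts-mono [] e = e [] [] refl
  Σcuts-mono (x ∷ w) e =
    +-mono-≤ (e [] (x ∷ w) refl) (Σcuts-mono w (λ P Q eq → e (x ∷ P) Q (cong (x ∷_) eq)))

  Σcuts-zero : ∀ (h : List A → List A → ℕ) w → (∀ P Q → P ++ Q ≡ w → h P Q ≡ 0) → Σcuts h w ≡ 0
  Σcuts-zero h w e = trans (Σcuts-cong w e) (zeros w)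
    where
    zeros : ∀ w → Σcuts (λ _ _ → 0) w ≡ 0
    zeros [] = refl
    zeros (_ ∷ w) = zeros w

  Σcuts-+ : ∀ (h₁ h₂ : List A → List A → ℕ) w →
    Σcuts (λ P Q → h₁ P Q + h₂ P Q) w ≡ Σcuts h₁ w + Σcuts h₂ w
  Σcuts-+ h₁ h₂ [] = refl
  Σcuts-+ h₁ h₂ (x ∷ w)
    rewrite Σcuts-+ (λ P Q → h₁ (x ∷ P) Q) (λ P Q → h₂ (x ∷ P) Q) w =
    interchange (h₁ [] (x ∷ w)) (h₂ [] (x ∷ w))
                (Σcuts (λ P Q → h₁ (x ∷ P) Q) w) (Σcuts (λ P Q → h₂ (x ∷ P) Q) w)
    where
    interchange : ∀ a b c d → a + b + (c + d) ≡ a + c + (b + d)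
    interchange = solve-∀

  Σcuts-*ʳ : ∀ c (h : List A → List A → ℕ) w → Σcuts (λ P Q → h P Q * c) w ≡ Σcuts h w * c
  Σcuts-*ʳ c h [] = refl
  Σcuts-*ʳ c h (x ∷ w) rewrite Σcuts-*ʳ c (λ P Q → h (x ∷ P) Q) w =
    sym (*-distribʳ-+ c (h [] (x ∷ w)) _)

  Σcuts-around : ∀ (h : List A → List A → ℕ) L x R →
    Σcuts h (L ++ x ∷ R) ≡ Σcuts (λ P Q → h P (Q ++ x ∷ R)) L + Σcuts (λ P Q → h (L ++ x ∷ P) Q) R
  Σcuts-around h [] x R = refl
  Σcuts-around h (y ∷ L) x R rewrite Σcuts-around (λ P Q → h (y ∷ P) Q) L x R =
    sym (+-assoc (h [] (y ∷ L ++ x ∷ R)) _ _)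

  Σcuts-prefix : ∀ (h : List A → List A → ℕ) X Y → Σcuts (λ P Q → h P (Q ++ Y)) X ≤ Σcuts h (X ++ Y)
  Σcuts-prefix h [] [] = ≤-refl
  Σcuts-prefix h [] (y ∷ Y) = m≤m+n _ _
  Σcuts-prefix h (x ∷ X) Y = +-monoʳ-≤ (h [] (x ∷ X ++ Y)) (Σcuts-prefix (λ P Q → h (x ∷ P) Q) X Y)

  -- δ w = 1 if w is empty and 0 otherwise: the unit for convolution of words.
  δ : List A → ℕ
  δ [] = 1
  δ (_ ∷ _) = 0

  Σcuts-δ : ∀ (h : List A → ℕ) w → Σcuts (λ P Q → h P * δ Q) w ≡ h w
  Σcuts-δ h [] = *-identityʳ (h [])
  Σcuts-δ h (x ∷ w) rewrite *-zeroʳ (h []) = Σcuts-δ (λ P → h (x ∷ P)) w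

cut-shorter : ∀ {A : Set} (P Q : List A) {w n} → P ++ Q ≡ w → length w < n → length P < n × length Q < n
cut-shorter P Q refl w<n =
  ≤-<-trans (m≤m+n (length P) (length Q)) PQ<n , ≤-<-trans (m≤n+m (length Q) (length P)) PQ<n
  where
  PQ<n : length P + length Q < _
  PQ<n = subst (_< _) (length-++ P) w<n

module _ {A B : Set} where

  concatCuts : (List A → List A → List B) → List A → List B
  concatCuts h [] = h [] []
  concatCuts h (x ∷ xs) = h [] (x ∷ xs) ++ concatCuts (λ P Q → h (x ∷ P) Q) xs

  concatCuts-cong : ∀ {h h′ : List A → List A → List B} w →
    (∀ P Q → P ++ Q ≡ w → h P Q ≡ h′ P Q) → concatCuts h w ≡ concatCuts h′ w
  concatCuts-cong [] e = e [] [] refl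
  concatCuts-cong (x ∷ w) e =
    cong₂ _++_ (e [] (x ∷ w) refl) (concatCuts-cong w (λ P Q eq → e (x ∷ P) Q (cong (x ∷_) eq)))

  length-concatCuts : ∀ (h : List A → List A → List B) w →
    length (concatCuts h w) ≡ Σcuts (λ P Q → length (h P Q)) w
  length-concatCuts h [] = refl
  length-concatCuts h (x ∷ w) =
    trans (length-++ (h [] (x ∷ w))) (cong (length (h [] (x ∷ w)) +_) (length-concatCuts _ w))

  ∈-concatCuts⁻ : ∀ {b} (h : List A → List A → List B) w → b ∈ concatCuts h w →
    ∃₂ λ P Q → P ++ Q ≡ w × b ∈ h P Q
  ∈-concatCuts⁻ h [] b∈ = [] , [] , refl , b∈
  ∈-concatCuts⁻ h (x ∷ w) b∈ with ∈-++⁻ (h [] (x ∷ w)) b∈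
  ... | inj₁ b∈h = [] , x ∷ w , refl , b∈h
  ... | inj₂ b∈rest =
    let (P , Q , e , b∈h) = ∈-concatCuts⁻ (λ P Q → h (x ∷ P) Q) w b∈rest
    in x ∷ P , Q , cong (x ∷_) e , b∈h

  ∈-concatCuts⁺ : ∀ {b} (h : List A → List A → List B) P Q → b ∈ h P Q → b ∈ concatCuts h (P ++ Q)
  ∈-concatCuts⁺ h [] [] b∈ = b∈
  ∈-concatCuts⁺ h [] (q ∷ Q) b∈ = ∈-++⁺ˡ b∈
  ∈-concatCuts⁺ h (p ∷ P) Q b∈ = ∈-++⁺ʳ (h [] (p ∷ P ++ Q)) (∈-concatCuts⁺ (λ P Q → h (p ∷ P) Q) P Q b∈)

  unique-concatCuts : ∀ (h : List A → List A → List B) w →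
    (∀ P Q → P ++ Q ≡ w → Unique (h P Q)) →
    (∀ {P Q P′ Q′ b} → P ++ Q ≡ w → P′ ++ Q′ ≡ w → b ∈ h P Q → b ∈ h P′ Q′ → length P ≡ length P′) →
    Unique (concatCuts h w)
  unique-concatCuts h [] u _ = u [] [] refl
  unique-concatCuts h (x ∷ w) u disj = Unique.++⁺ (u [] (x ∷ w) refl)
    (unique-concatCuts (λ P Q → h (x ∷ P) Q) w (λ P Q e → u (x ∷ P) Q (cong (x ∷_) e))
       (λ e e′ b∈ b∈′ → suc-injective (disj (cong (x ∷_) e) (cong (x ∷_) e′) b∈ b∈′)))
    (λ (b∈h , b∈rest) →
      let (P , Q , e , b∈h′) = ∈-concatCuts⁻ (λ P Q → h (x ∷ P) Q) w b∈rest
      in 0≢1+n (disj refl (cong (x ∷_) e) b∈h b∈h′))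

-- 2. Convolution powers of a word function.

-- conv f h n = Σ_{a + b = n} f a · h b, the convolution of number sequences.
conv : (ℕ → ℕ) → (ℕ → ℕ) → ℕ → ℕ
conv f h zero = f 0 * h 0
conv f h (suc n) = f 0 * h (suc n) + conv (f ∘ suc) h n

conv-cong : ∀ {f f′ : ℕ → ℕ} (h : ℕ → ℕ) n → (∀ a → f a ≡ f′ a) → conv f h n ≡ conv f′ h n
conv-cong h zero e = cong (_* h 0) (e 0)
conv-cong h (suc n) e = cong₂ _+_ (cong (_* h (suc n)) (e 0)) (conv-cong h n (e ∘ suc))

conv-*ˡ : ∀ c (f h : ℕ → ℕ) n → conv (λ a → c * f a) h n ≡ c * conv f h n
conv-*ˡ c f h zero = *-assoc c (f 0) (h 0)
conv-*ˡ c f h (suc n) rewrite conv-*ˡ c (f ∘ suc) h n | *-assoc c (f 0) (h (suc n)) =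
  sym (*-distribˡ-+ c (f 0 * h (suc n)) _)

conv-Σcuts : ∀ (φ : ℕ → List ℕ → List ℕ → ℕ) (h : ℕ → ℕ) X n →
  conv (λ a → Σcuts (φ a) X) h n ≡ Σcuts (λ P Q → conv (λ a → φ a P Q) h n) X
conv-Σcuts φ h X zero = sym (Σcuts-*ʳ (h 0) (φ 0) X)
conv-Σcuts φ h X (suc n) rewrite conv-Σcuts (φ ∘ suc) h X n
  | Σcuts-+ (λ P Q → φ 0 P Q * h (suc n)) (λ P Q → conv (λ a → φ (suc a) P Q) h n) X
  | Σcuts-*ʳ (h (suc n)) (φ 0) X = refl

conv-shift-≤ : ∀ (f h : ℕ → ℕ) m j → conv (λ a → f (m + a)) h j ≤ conv f h (m + j)
conv-shift-≤ f h zero j = ≤-refl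
conv-shift-≤ f h (suc m) j = ≤-trans (conv-shift-≤ (f ∘ suc) h m j) (m≤n+m _ _)

conv-one-suc : ∀ (h : ℕ → ℕ) n → conv (λ _ → 1) h (suc n) ≡ h (suc n) + conv (λ _ → 1) h n
conv-one-suc h n = cong (_+ conv (λ _ → 1) h n) (+-identityʳ (h (suc n)))

-- For a word function g with g [] = 1, the convolution powers
--   F j w  = Σ_{w = A₁ ⋯ Aⱼ} g A₁ ⋯ g Aⱼ     (F 0 = δ, F 1 = g)
--   F⁺ j w = the same sum restricted to A₁ nonempty (for j ≥ 1).
module Powers (g : List ℕ → ℕ) (g[] : g [] ≡ 1) where

  F : ℕ → List ℕ → ℕ
  F zero w = δ w
  F (suc j) w = Σcuts (λ P Q → g P * F j Q) w

  F⁺ : ℕ → List ℕ → ℕ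
  F⁺ zero w = δ w
  F⁺ (suc j) [] = 0
  F⁺ (suc j) (x ∷ xs) = Σcuts (λ P Q → g (x ∷ P) * F j Q) xs

  F-[] : ∀ j → F j [] ≡ 1
  F-[] zero = refl
  F-[] (suc j) = cong₂ _*_ g[] (F-[] j)

  F-one : ∀ w → F 1 w ≡ g w
  F-one = Σcuts-δ g

  F⁺-one : ∀ y Y → F⁺ 1 (y ∷ Y) ≡ g (y ∷ Y)
  F⁺-one y Y = Σcuts-δ (λ P → g (y ∷ P)) Y

  -- Split off the case that the first block is empty.
  F-suc : ∀ j Y → F (suc j) Y ≡ F j Y + F⁺ (suc j) Y
  F-suc j [] = trans (cong₂ _*_ g[] (F-[] j)) (cong (_+ 0) (sym (F-[] j)))
  F-suc j (y ∷ Y) =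
    cong (_+ F⁺ (suc j) (y ∷ Y)) (trans (cong (_* F j (y ∷ Y)) g[]) (+-identityʳ (F j (y ∷ Y))))

  -- Classifying by the position d of the first nonempty block:
  -- F n Y = Σ_{d ≤ n} F⁺ d Y.
  F-by-first-block : ∀ n Y → F n Y ≡ conv (λ _ → 1) (λ d → F⁺ d Y) n
  F-by-first-block zero Y = sym (+-identityʳ (δ Y))
  F-by-first-block (suc n) Y rewrite conv-one-suc (λ d → F⁺ d Y) n | F-suc n Y | F-by-first-block n Y =
    +-comm (conv (λ _ → 1) (λ d → F⁺ d Y) n) _

  -- Superadditivity: gluing a factorisation of X (a blocks) to one of Y whose
  -- first block is nonempty (n ∸ a blocks) gives distinct factorisations of X ++ Y.
  F-superadditive : ∀ Y n X → conv (λ a → F a X) (λ d → F⁺ d Y) n ≤ F n (X ++ Y)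
  F-superadditive Y n [] =
    ≤-reflexive (trans (conv-cong _ n F-[]) (sym (F-by-first-block n Y)))
  F-superadditive Y zero (x ∷ X) = z≤n
  F-superadditive Y (suc n) (x ∷ X) = begin
      conv (λ a → F (suc a) (x ∷ X)) (λ d → F⁺ d Y) n
        ≡⟨ conv-Σcuts (λ a P Q → g P * F a Q) (λ d → F⁺ d Y) (x ∷ X) n ⟩
      Σcuts (λ P Q → conv (λ a → g P * F a Q) (λ d → F⁺ d Y) n) (x ∷ X)
        ≡⟨ Σcuts-cong (x ∷ X) (λ P Q _ → conv-*ˡ (g P) (λ a → F a Q) (λ d → F⁺ d Y) n) ⟩
      Σcuts (λ P Q → g P * conv (λ a → F a Q) (λ d → F⁺ d Y) n) (x ∷ X)
        ≤⟨ Σcuts-mono (x ∷ X) (λ P Q _ → *-monoʳ-≤ (g P) (F-superadditive Y n Q)) ⟩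
      Σcuts (λ P Q → g P * F n (Q ++ Y)) (x ∷ X)
        ≤⟨ Σcuts-prefix (λ P Q → g P * F n Q) (x ∷ X) Y ⟩
      F (suc n) (x ∷ X ++ Y) ∎
    where open ≤-Reasoning

  conv-F⁺-[] : ∀ (f : ℕ → ℕ) j → conv f (λ d → F⁺ d []) j ≡ f j
  conv-F⁺-[] f zero = *-identityʳ (f 0)
  conv-F⁺-[] f (suc j) rewrite *-zeroʳ (f 0) = conv-F⁺-[] (f ∘ suc) j

  -- The cross sums  cross X Y m j = Σ_{i < j} F (m + i) X · F (j ∸ 1 ∸ i) Y,
  -- in terms of which the splitting formula below is expressed.
  cross : List ℕ → List ℕ → ℕ → ℕ → ℕ
  cross X Y m zero = 0
  cross X Y m (suc j) = F m X * F j Y + cross X Y (suc m) j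

  -- Increasing j adds, through F-suc, one convolution term in every summand.
  cross-suc : ∀ X Y j m →
    cross X Y m (suc j) ≡ cross X Y m j + conv (λ a → F (m + a) X) (λ d → F⁺ d Y) j
  cross-suc X Y zero m rewrite +-identityʳ m = +-identityʳ _
  cross-suc X Y (suc j) m rewrite cross-suc X Y j (suc m) | F-suc j Y | +-identityʳ m
    | conv-cong (λ d → F⁺ d Y) j (λ a → cong (λ z → F z X) (+-suc m a)) =
    regroup (F m X) (F j Y) (F⁺ (suc j) Y) (cross X Y (suc m) j)
            (conv (λ a → F (suc m + a) X) (λ d → F⁺ d Y) j)
    where
    regroup : ∀ a b c d e → a * (b + c) + (d + e) ≡ a * b + d + (a * c + e)
    regroup = solve-∀

  cross-term-≤ : ∀ X Y m j →
    conv (λ a → F (m + a) X) (λ d → F⁺ d Y) j ≤ conv (λ a → F (m + a) (X ++ Y)) (λ d → F⁺ d []) j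
  cross-term-≤ X Y m j = begin
    conv (λ a → F (m + a) X) (λ d → F⁺ d Y) j   ≤⟨ conv-shift-≤ (λ a → F a X) (λ d → F⁺ d Y) m j ⟩
    conv (λ a → F a X) (λ d → F⁺ d Y) (m + j)   ≤⟨ F-superadditive Y (m + j) X ⟩
    F (m + j) (X ++ Y)                          ≡⟨ sym (conv-F⁺-[] (λ a → F (m + a) (X ++ Y)) j) ⟩
    conv (λ a → F (m + a) (X ++ Y)) (λ d → F⁺ d []) j ∎
    where open ≤-Reasoning

  -- Merging the two arguments of a cross sum can only increase it ...
  cross-merge-≤ : ∀ X Y m j → cross X Y m j ≤ cross (X ++ Y) [] m j
  cross-merge-≤ X Y m zero = z≤n
  cross-merge-≤ X Y m (suc j) rewrite cross-suc X Y j m | cross-suc (X ++ Y) [] j m =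
    +-mono-≤ (cross-merge-≤ X Y m j) (cross-term-≤ X Y m j)

  -- ... and strictly so when X and a nonempty Y have factorisations into one
  -- block, since gluing these gives a factorisation of X ++ Y into two blocks
  -- that the left-hand side misses.
  cross-merge-< : ∀ X Y → 1 ≤ g X → 1 ≤ F⁺ 1 Y → ∀ j → cross X Y 2 (suc j) < cross (X ++ Y) [] 2 (suc j)
  cross-merge-< X Y gX gY zero rewrite F-[] 0 | +-identityʳ (F 2 X * δ Y) | +-identityʳ (F 2 (X ++ Y) * 1)
    | *-identityʳ (F 2 (X ++ Y)) = begin-strict
      F 2 X * δ Y                          <⟨ extra-term {b = F 0 X * F⁺ 2 Y} (*-mono-≤ FX gY) ⟩
      conv (λ a → F a X) (λ d → F⁺ d Y) 2  ≤⟨ F-superadditive Y 2 X ⟩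
      F 2 (X ++ Y) ∎
    where
    open ≤-Reasoning
    FX : 1 ≤ F 1 X
    FX = ≤-trans gX (≤-reflexive (sym (F-one X)))
    extra-term : ∀ {a b c} → 1 ≤ c → a < b + (c + a)
    extra-term {a} {b} {suc c} _ = ≤-trans (s≤s (m≤n+m a c)) (m≤n+m _ b)
  cross-merge-< X Y gX gY (suc j) rewrite cross-suc X Y (suc j) 2 | cross-suc (X ++ Y) [] (suc j) 2 =
    +-mono-<-≤ (cross-merge-< X Y gX gY j) (cross-term-≤ X Y 2 (suc j))

  cross-mono : ∀ {L L′ R R′} → (∀ i → F i L ≤ F i L′) → (∀ i → F i R ≤ F i R′) →
    ∀ m j → cross L R m j ≤ cross L′ R′ m j
  cross-mono L≤ R≤ m zero = z≤n
  cross-mono L≤ R≤ m (suc j) = +-mono-≤ (*-mono-≤ (L≤ m) (R≤ j)) (cross-mono L≤ R≤ (suc m) j)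

  -- Suppose g obeys the fertility recursion at the
  -- letter k: a word ending in k, preceded by smaller letters, has weight
  -- Σ over its cuts of products, and a word with k not in last position but
  -- followed only by smaller letters has weight 0.  Then, for L, R below k,
  --   F j (L ++ k ∷ R) = Σ_{i < j} F (2 + i) L · F (j ∸ 1 ∸ i) R.
  module Splitting (k : ℕ)
    (g-ending-at : ∀ L → All (_< k) L → g (L ++ k ∷ []) ≡ Σcuts (λ A B → g A * g B) L)
    (g-vanishes : ∀ L z Z → All (_< k) (z ∷ Z) → g (L ++ k ∷ z ∷ Z) ≡ 0) where

    g-ending-at-F : ∀ L → All (_< k) L → g (L ++ k ∷ []) ≡ F 2 L
    g-ending-at-F L L<k =
      trans (g-ending-at L L<k) (Σcuts-cong L (λ A B _ → cong (g A *_) (sym (F-one B))))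

    Σcuts-cross : ∀ R j m L → Σcuts (λ P Q → g P * cross Q R m j) L ≡ cross L R (suc m) j
    Σcuts-cross R zero m L = Σcuts-zero _ L (λ P Q _ → *-zeroʳ (g P))
    Σcuts-cross R (suc j) m L = begin
        Σcuts (λ P Q → g P * (F m Q * F j R + cross Q R (suc m) j)) L
          ≡⟨ Σcuts-cong L (λ P Q _ → distrib (g P) (F m Q) (F j R) (cross Q R (suc m) j)) ⟩
        Σcuts (λ P Q → g P * F m Q * F j R + g P * cross Q R (suc m) j) L
          ≡⟨ Σcuts-+ _ _ L ⟩
        Σcuts (λ P Q → g P * F m Q * F j R) L + Σcuts (λ P Q → g P * cross Q R (suc m) j) L
          ≡⟨ cong₂ _+_ (Σcuts-*ʳ (F j R) (λ P Q → g P * F m Q) L) (Σcuts-cross R j (suc m) L) ⟩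
        F (suc m) L * F j R + cross L R (suc (suc m)) j ∎
      where
      open ≡-Reasoning
      distrib : ∀ a b c d → a * (b * c + d) ≡ a * b * c + a * d
      distrib = solve-∀

    -- The block containing k must end at k, so it is (suffix of L) ++ [k].
    block-at-k : ∀ j L R → All (_< k) L → All (_< k) R →
      Σcuts (λ P Q → g (L ++ k ∷ P) * F j Q) R ≡ F 2 L * F j R
    block-at-k j L [] L<k _ = cong (_* F j []) (g-ending-at-F L L<k)
    block-at-k j L (r ∷ R) L<k R<k = begin
        g (L ++ k ∷ []) * F j (r ∷ R) + Σcuts (λ P Q → g (L ++ k ∷ r ∷ P) * F j Q) R
          ≡⟨ cong (g (L ++ k ∷ []) * F j (r ∷ R) +_) (Σcuts-zero _ R vanish) ⟩
        g (L ++ k ∷ []) * F j (r ∷ R) + 0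
          ≡⟨ +-identityʳ _ ⟩
        g (L ++ k ∷ []) * F j (r ∷ R)
          ≡⟨ cong (_* F j (r ∷ R)) (g-ending-at-F L L<k) ⟩
        F 2 L * F j (r ∷ R) ∎
      where
      open ≡-Reasoning
      vanish : ∀ P Q → P ++ Q ≡ R → g (L ++ k ∷ r ∷ P) * F j Q ≡ 0
      vanish P Q refl = cong (_* F j Q) (g-vanishes L r P (AllP.++⁻ˡ (r ∷ P) R<k))

    F-split : ∀ j L R → All (_< k) L → All (_< k) R → F j (L ++ k ∷ R) ≡ cross L R 2 j
    F-split zero [] R _ _ = refl
    F-split zero (_ ∷ _) R _ _ = refl
    F-split (suc j) L R L<k R<k = begin
        Σcuts (λ P Q → g P * F j Q) (L ++ k ∷ R)
          ≡⟨ Σcuts-around _ L k R ⟩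
        Σcuts (λ P Q → g P * F j (Q ++ k ∷ R)) L + Σcuts (λ P Q → g (L ++ k ∷ P) * F j Q) R
          ≡⟨ cong₂ _+_ (Σcuts-cong L inner) (block-at-k j L R L<k R<k) ⟩
        Σcuts (λ P Q → g P * cross Q R 2 j) L + F 2 L * F j R
          ≡⟨ cong (_+ F 2 L * F j R) (Σcuts-cross R j 2 L) ⟩
        cross L R 3 j + F 2 L * F j R
          ≡⟨ +-comm (cross L R 3 j) _ ⟩
        cross L R 2 (suc j) ∎
      where
      open ≡-Reasoning
      inner : ∀ P Q → P ++ Q ≡ L → g P * F j (Q ++ k ∷ R) ≡ g P * cross Q R 2 j
      inner P Q refl = cong (g P *_) (F-split j Q R (AllP.++⁻ʳ P L<k) R<k)

-- 3. The stack-sorting map.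

maxL-∈ : ∀ x xs → maxL (x ∷ xs) ∈ x ∷ xs
maxL-∈ x [] rewrite ⊔-identityʳ x = here refl
maxL-∈ x (y ∷ ys) with ⊔-sel x (maxL (y ∷ ys))
... | inj₁ e rewrite e = here refl
... | inj₂ e rewrite e = there (maxL-∈ y ys)

maxL-upper : ∀ {y} π → y ∈ π → y ≤ maxL π
maxL-upper (x ∷ xs) (here refl) = m≤m⊔n x (maxL xs)
maxL-upper (x ∷ xs) (there y∈) = ≤-trans (maxL-upper xs y∈) (m≤n⊔m x (maxL xs))

maxL-least : ∀ {m} R → All (_≤ m) R → maxL R ≤ m
maxL-least [] [] = z≤n
maxL-least (x ∷ R) (x≤m ∷ R≤m) = ⊔-lub x≤m (maxL-least R R≤m)

maxL-cut : ∀ {m} L R → All (_< m) L → All (_< m) R → maxL (L ++ m ∷ R) ≡ m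
maxL-cut [] R _ R<m = m≥n⇒m⊔n≡m (maxL-least R (All.map <⇒≤ R<m))
maxL-cut (l ∷ L) R (l<m ∷ L<m) R<m rewrite maxL-cut L R L<m R<m = m≤n⇒m⊔n≡n (<⇒≤ l<m)

below⇒∉ : ∀ {m} L → All (_< m) L → m ∉ L
below⇒∉ L L<m m∈L = <-irrefl refl (All.lookup L<m m∈L)

-- The equality test inside splitAt computes with the boolean x ≡ᵇ m.
≡ᵇ-true : ∀ x m → (x ≡ᵇ m) ≡ true → x ≡ m
≡ᵇ-true x m eq = ≡ᵇ⇒≡ x m (subst T (sym eq) tt)

≡ᵇ-false : ∀ x m → (x ≡ᵇ m) ≡ false → x ≢ m
≡ᵇ-false x .x eq refl = subst T eq (≡⇒≡ᵇ x x refl)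

splitAt-cut : ∀ m π → m ∈ π → π ≡ proj₁ (splitAt m π) ++ m ∷ proj₂ (splitAt m π)
splitAt-cut m (x ∷ xs) m∈ with x ≡ᵇ m in eq
... | true rewrite ≡ᵇ-true x m eq = refl
... | false with m∈
...   | here m≡x = ⊥-elim (≡ᵇ-false x m eq (sym m≡x))
...   | there m∈xs = cong (x ∷_) (splitAt-cut m xs m∈xs)

splitAt-first : ∀ m L R → m ∉ L → splitAt m (L ++ m ∷ R) ≡ (L , R)
splitAt-first m [] R _ with m ≡ᵇ m in eq
... | true = refl
... | false = ⊥-elim (≡ᵇ-false m m eq refl)
splitAt-first m (l ∷ L) R m∉ with l ≡ᵇ m in eq
... | true = ⊥-elim (m∉ (here (sym (≡ᵇ-true l m eq))))
... | false rewrite splitAt-first m L R (m∉ ∘ there) = refl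

length-cut : ∀ (L : List ℕ) m R → length (L ++ m ∷ R) ≡ suc (length L + length R)
length-cut L m R = trans (length-++ L) (+-suc (length L) (length R))

around-shorter : ∀ (L : List ℕ) m R {n} → length (L ++ m ∷ R) < suc n → length L < n × length R < n
around-shorter L m R LmR<n =
  ≤-<-trans (m≤m+n (length L) (length R)) LR<n , ≤-<-trans (m≤n+m (length R) (length L)) LR<n
  where
  LR<n : length L + length R < _
  LR<n = ≤-pred (subst (_< suc _) (length-cut L m R) LmR<n)

max-decomposition : ∀ x xs → Unique (x ∷ xs) →
  ∃ λ m → ∃₂ λ L R → x ∷ xs ≡ L ++ m ∷ R × All (_< m) L × All (_< m) R
max-decomposition x xs u =
  m , L , R , cut , All.tabulate (below ∘ ∈-++⁺ˡ) , All.tabulate (below ∘ ∈-++⁺ʳ L)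
  where
  m : ℕ
  m = maxL (x ∷ xs)
  L : List ℕ
  L = proj₁ (splitAt m (x ∷ xs))
  R : List ℕ
  R = proj₂ (splitAt m (x ∷ xs))
  cut : x ∷ xs ≡ L ++ m ∷ R
  cut = splitAt-cut m (x ∷ xs) (maxL-∈ x xs)
  m∉ : m ∉ L ++ R
  m∉ = unique-head (Unique-resp-↭ (shift m L R) (subst Unique cut u))
  below : ∀ {y} → y ∈ L ++ R → y < m
  below {y} y∈ = ≤∧≢⇒< (maxL-upper (x ∷ xs) (subst (y ∈_) (sym cut) (insert y∈)))
                       (λ { refl → m∉ y∈ })
    where
    insert : ∀ {y} → y ∈ L ++ R → y ∈ L ++ m ∷ R
    insert y∈ with ∈-++⁻ L y∈
    ... | inj₁ y∈L = ∈-++⁺ˡ y∈L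
    ... | inj₂ y∈R = ∈-++⁺ʳ L (there y∈R)

sFuel-step : ∀ k π → π ≢ [] →
  sFuel (suc k) π ≡ sFuel k (proj₁ (splitAt (maxL π) π)) ++ sFuel k (proj₂ (splitAt (maxL π) π)) ++ maxL π ∷ []
sFuel-step k [] π≢[] = ⊥-elim (π≢[] refl)
sFuel-step k (x ∷ xs) _ = refl

split-shorter : ∀ x xs → let sp = splitAt (maxL (x ∷ xs)) (x ∷ xs) in
  length (proj₁ sp) ≤ length xs × length (proj₂ sp) ≤ length xs
split-shorter x xs = ≤-trans (m≤m+n _ _) total , ≤-trans (m≤n+m _ _) total
  where
  sp : List ℕ × List ℕ
  sp = splitAt (maxL (x ∷ xs)) (x ∷ xs)
  total : length (proj₁ sp) + length (proj₂ sp) ≤ length xs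
  total = ≤-pred (≤-reflexive (sym (trans (cong length (splitAt-cut _ (x ∷ xs) (maxL-∈ x xs)))
                                          (length-cut (proj₁ sp) _ (proj₂ sp)))))

sFuel-enough : ∀ k π → length π ≤ k → sFuel k π ≡ s π
sFuel-enough k π π≤k = agree k (length π) π π≤k ≤-refl
  where
  agree : ∀ k k′ π → length π ≤ k → length π ≤ k′ → sFuel k π ≡ sFuel k′ π
  agree zero zero [] _ _ = refl
  agree zero (suc k′) [] _ _ = refl
  agree (suc k) zero [] _ _ = refl
  agree (suc k) (suc k′) [] _ _ = refl
  agree (suc k) (suc k′) (x ∷ xs) (s≤s xs≤k) (s≤s xs≤k′) =
    let (L≤ , R≤) = split-shorter x xs in
    cong₂ _++_ (agree k k′ _ (≤-trans L≤ xs≤k) (≤-trans L≤ xs≤k′))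
               (cong (_++ _) (agree k k′ _ (≤-trans R≤ xs≤k) (≤-trans R≤ xs≤k′)))

s-↭ : ∀ π → s π ↭ π
s-↭ π = sFuel-↭ (length π) π
  where
  sFuel-↭ : ∀ k π → sFuel k π ↭ π
  sFuel-↭ zero π = ↭-refl
  sFuel-↭ (suc k) [] = ↭-refl
  sFuel-↭ (suc k) (x ∷ xs) =
    ↭-trans (++⁺ (sFuel-↭ k L) (++⁺ (sFuel-↭ k R) ↭-refl))
    (↭-trans (++⁺ˡ L (↭-sym (∷↭∷ʳ m R)))
    (↭-reflexive (sym (splitAt-cut m (x ∷ xs) (maxL-∈ x xs)))))
    where
    m : ℕ
    m = maxL (x ∷ xs)
    L : List ℕ
    L = proj₁ (splitAt m (x ∷ xs))
    R : List ℕ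
    R = proj₂ (splitAt m (x ∷ xs))

length-s : ∀ π → length (s π) ≡ length π
length-s π = ↭-length (s-↭ π)

below-s : ∀ {m} π → All (_< m) π → All (_< m) (s π)
below-s π π<m = All-resp-↭ (↭-sym (s-↭ π)) π<m

below-s⁻ : ∀ {m} π → All (_< m) (s π) → All (_< m) π
below-s⁻ π sπ<m = All-resp-↭ (s-↭ π) sπ<m

s-split : ∀ m L R → All (_< m) L → All (_< m) R → s (L ++ m ∷ R) ≡ s L ++ s R ++ m ∷ []
s-split m L R L<m R<m = begin
    sFuel (length (L ++ m ∷ R)) (L ++ m ∷ R)
      ≡⟨ cong (λ k → sFuel k (L ++ m ∷ R)) (length-cut L m R) ⟩
    sFuel (suc n) (L ++ m ∷ R)
      ≡⟨ sFuel-step n (L ++ m ∷ R) (nonempty L) ⟩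
    sFuel n (proj₁ sp) ++ sFuel n (proj₂ sp) ++ maxL (L ++ m ∷ R) ∷ []
      ≡⟨ cong₂ (λ μ p → sFuel n (proj₁ p) ++ sFuel n (proj₂ p) ++ μ ∷ []) (maxL-cut L R L<m R<m) split ⟩
    sFuel n L ++ sFuel n R ++ m ∷ []
      ≡⟨ cong₂ (λ A B → A ++ B ++ m ∷ []) (sFuel-enough n L (m≤m+n _ _)) (sFuel-enough n R (m≤n+m _ _)) ⟩
    s L ++ s R ++ m ∷ [] ∎
  where
  open ≡-Reasoning
  n : ℕ
  n = length L + length R
  sp : List ℕ × List ℕ
  sp = splitAt (maxL (L ++ m ∷ R)) (L ++ m ∷ R)
  split : sp ≡ (L , R)
  split = trans (cong (λ μ → splitAt μ (L ++ m ∷ R)) (maxL-cut L R L<m R<m)) (splitAt-first m L R (below⇒∉ L L<m))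
  nonempty : ∀ L → L ++ m ∷ R ≢ []
  nonempty [] ()
  nonempty (_ ∷ _) ()

-- 4. An explicit enumeration of the preimages of s.

-- splitLast x xs = (init , last) of the nonempty list x ∷ xs; the
-- enumeration recurses on the last letter of σ.
splitLast : ℕ → List ℕ → List ℕ × ℕ
splitLast x [] = [] , x
splitLast x (y ∷ ys) = map₁ (x ∷_) (splitLast y ys)

splitLast-snoc : ∀ x I l → splitLast x (I ++ l ∷ []) ≡ (x ∷ I , l)
splitLast-snoc x [] l = refl
splitLast-snoc x (i ∷ I) l rewrite splitLast-snoc i I l = refl

splitLast-cut : ∀ x xs → x ∷ xs ≡ proj₁ (splitLast x xs) ++ proj₂ (splitLast x xs) ∷ []
splitLast-cut x [] = refl
splitLast-cut x (y ∷ ys) = cong (x ∷_) (splitLast-cut y ys)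

length-splitLast : ∀ x xs → length (proj₁ (splitLast x xs)) ≡ length xs
length-splitLast x [] = refl
length-splitLast x (y ∷ ys) = cong suc (length-splitLast y ys)

glue : ℕ → List (List ℕ) → List (List ℕ) → List (List ℕ)
glue m Ls Rs = concatMap (λ L → map (λ R → L ++ m ∷ R) Rs) Ls

length-glue : ∀ m Ls Rs → length (glue m Ls Rs) ≡ length Ls * length Rs
length-glue m [] Rs = refl
length-glue m (L ∷ Ls) Rs =
  trans (length-++ (map (λ R → L ++ m ∷ R) Rs))
        (cong₂ _+_ (length-map (λ R → L ++ m ∷ R) Rs) (length-glue m Ls Rs))

∈-glue⁻ : ∀ {τ} m Ls Rs → τ ∈ glue m Ls Rs → ∃₂ λ L R → L ∈ Ls × R ∈ Rs × τ ≡ L ++ m ∷ R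
∈-glue⁻ m Ls Rs τ∈ =
  let (L , L∈ , τ∈L) = find (∈-concatMap⁻ (λ L → map (λ R → L ++ m ∷ R) Rs) {xs = Ls} τ∈)
      (R , R∈ , τ≡) = ∈-map⁻ (λ R → L ++ m ∷ R) τ∈L
  in L , R , L∈ , R∈ , τ≡

∈-glue⁺ : ∀ m {Ls Rs L R} → L ∈ Ls → R ∈ Rs → L ++ m ∷ R ∈ glue m Ls Rs
∈-glue⁺ m {Rs = Rs} L∈ R∈ =
  ∈-concatMap⁺ (λ L → map (λ R → L ++ m ∷ R) Rs) (Any.map (λ { refl → ∈-map⁺ _ R∈ }) L∈)

unique-glue : ∀ m Ls Rs → Unique Ls → Unique Rs → (∀ {L} → L ∈ Ls → m ∉ L) → Unique (glue m Ls Rs)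
unique-glue m Ls Rs uL uR m∉ = unique-concatMap (λ L → map (λ R → L ++ m ∷ R) Rs) Ls uL
  (λ {L} _ → Unique.map⁺ (λ e → ∷-injectiveʳ (++-cancelˡ L _ _ e)) uR)
  (λ {L} {L′} L∈ L′∈ τ∈ τ∈′ →
     let (_ , _ , e) = ∈-map⁻ (λ R → L ++ m ∷ R) τ∈
         (_ , _ , e′) = ∈-map⁻ (λ R → L′ ++ m ∷ R) τ∈′
     in proj₁ (cut-unique L L′ (m∉ L∈) (m∉ L′∈) (trans (sym e) e′)))

-- preimages k σ lists the τ with s τ ≡ σ whenever length σ < k (k is fuel).
-- By s(L m R) = s(L) s(R) m, the preimages of I ++ [m] are the L ++ m ∷ R
-- with s L ++ s R ≡ I, provided every entry of I is below m; otherwise none.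
preimages : ℕ → List ℕ → List (List ℕ)
preimagesEnding : ℕ → List ℕ → ℕ → List (List ℕ)
preimagesEnding′ : ℕ → (I : List ℕ) (m : ℕ) → Dec (All (_< m) I) → List (List ℕ)

preimages zero σ = []
preimages (suc k) [] = [] ∷ []
preimages (suc k) (x ∷ xs) = preimagesEnding k (proj₁ (splitLast x xs)) (proj₂ (splitLast x xs))

preimagesEnding k I m = preimagesEnding′ k I m (all? (_<? m) I)

preimagesEnding′ k I m (yes _) = concatCuts (λ A B → glue m (preimages k A) (preimages k B)) I
preimagesEnding′ k I m (no _) = []

preimages-snoc : ∀ k I m → preimages (suc k) (I ++ m ∷ []) ≡ preimagesEnding k I m
preimages-snoc k [] m = refl
preimages-snoc k (i ∷ I) m rewrite splitLast-snoc i I m = refl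

preimagesEnding-below : ∀ k I m → All (_< m) I →
  preimagesEnding k I m ≡ concatCuts (λ A B → glue m (preimages k A) (preimages k B)) I
preimagesEnding-below k I m I<m with all? (_<? m) I
... | yes _ = refl
... | no I≮m = ⊥-elim (I≮m I<m)

preimagesEnding-not-below : ∀ k I m → ¬ All (_< m) I → preimagesEnding k I m ≡ []
preimagesEnding-not-below k I m I≮m with all? (_<? m) I
... | yes I<m = ⊥-elim (I≮m I<m)
... | no _ = refl

∈-preimagesEnding : ∀ {τ} k I m → τ ∈ preimagesEnding k I m →
  All (_< m) I × τ ∈ concatCuts (λ A B → glue m (preimages k A) (preimages k B)) I
∈-preimagesEnding k I m τ∈ with all? (_<? m) I
... | yes I<m = I<m , τ∈

preimages-fuel : ∀ a b σ → length σ < a → length σ < b → preimages a σ ≡ preimages b σ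
preimages-fuel (suc a) (suc b) [] _ _ = refl
preimages-fuel (suc a) (suc b) (x ∷ xs) (s≤s xs<a) (s≤s xs<b) with all? (_<? proj₂ (splitLast x xs)) (proj₁ (splitLast x xs))
... | no _ = refl
... | yes _ = concatCuts-cong I λ A B e →
  let (A<a , B<a) = cut-shorter A B e (I<xs xs<a)
      (A<b , B<b) = cut-shorter A B e (I<xs xs<b)
  in cong₂ (glue _) (preimages-fuel a b A A<a A<b) (preimages-fuel a b B B<a B<b)
  where
  I : List ℕ
  I = proj₁ (splitLast x xs)
  I<xs : ∀ {c} → length xs < c → length I < c
  I<xs = subst (_< _) (sym (length-splitLast x xs))

fert : List ℕ → ℕ
fert σ = length (preimages (suc (length σ)) σ)

length-preimages : ∀ a σ → length σ < a → length (preimages a σ) ≡ fert σ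
length-preimages a σ σ<a = cong length (preimages-fuel a (suc (length σ)) σ σ<a ≤-refl)

fert-ending-at : ∀ I m → All (_< m) I → fert (I ++ m ∷ []) ≡ Σcuts (λ A B → fert A * fert B) I
fert-ending-at I m I<m = begin
    length (preimages (suc k) (I ++ m ∷ []))
      ≡⟨ cong length (trans (preimages-snoc k I m) (preimagesEnding-below k I m I<m)) ⟩
    length (concatCuts (λ A B → glue m (preimages k A) (preimages k B)) I)
      ≡⟨ length-concatCuts _ I ⟩
    Σcuts (λ A B → length (glue m (preimages k A) (preimages k B))) I
      ≡⟨ Σcuts-cong I count-glue ⟩
    Σcuts (λ A B → fert A * fert B) I ∎
  where
  open ≡-Reasoning
  k : ℕ
  k = length (I ++ m ∷ [])
  I<k : length I < k
  I<k = ≤-reflexive (sym (trans (length-++ I) (+-comm _ 1)))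
  count-glue : ∀ A B → A ++ B ≡ I → length (glue m (preimages k A) (preimages k B)) ≡ fert A * fert B
  count-glue A B e =
    let (A<k , B<k) = cut-shorter A B e I<k
    in trans (length-glue m (preimages k A) (preimages k B))
             (cong₂ _*_ (length-preimages k A A<k) (length-preimages k B B<k))

fert-vanishes : ∀ L k z Z → All (_< k) (z ∷ Z) → fert (L ++ k ∷ z ∷ Z) ≡ 0
fert-vanishes L k z Z z∷Z<k =
  trans (cong fert as-snoc)
        (cong length (trans (preimages-snoc _ (L ++ k ∷ I) l) (preimagesEnding-not-below _ (L ++ k ∷ I) l k≮l)))
  where
  I : List ℕ
  I = proj₁ (splitLast z Z)
  l : ℕ
  l = proj₂ (splitLast z Z)
  as-snoc : L ++ k ∷ z ∷ Z ≡ (L ++ k ∷ I) ++ l ∷ []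
  as-snoc = trans (cong (λ t → L ++ k ∷ t) (splitLast-cut z Z)) (sym (++-assoc L (k ∷ I) (l ∷ [])))
  l<k : l < k
  l<k = All.lookup z∷Z<k (subst (l ∈_) (sym (splitLast-cut z Z)) (∈-++⁺ʳ I (here refl)))
  k≮l : ¬ All (_< l) (L ++ k ∷ I)
  k≮l below = <-asym l<k (All.lookup below (∈-++⁺ʳ L (here refl)))

preimages-sound : ∀ a σ τ → τ ∈ preimages a σ → s τ ≡ σ
preimages-sound (suc k) [] τ (here refl) = refl
preimages-sound (suc k) (x ∷ xs) τ τ∈ with ∈-preimagesEnding k (proj₁ (splitLast x xs)) (proj₂ (splitLast x xs)) τ∈
... | I<m , τ∈′ with ∈-concatCuts⁻ _ (proj₁ (splitLast x xs)) τ∈′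
... | A , B , AB≡I , τ∈glue with ∈-glue⁻ (proj₂ (splitLast x xs)) (preimages k A) (preimages k B) τ∈glue
... | L , R , L∈ , R∈ , refl = begin
    s (L ++ m ∷ R)        ≡⟨ s-split m L R L<m R<m ⟩
    s L ++ s R ++ m ∷ []  ≡⟨ cong₂ (λ X Y → X ++ Y ++ m ∷ []) sL≡A sR≡B ⟩
    A ++ B ++ m ∷ []      ≡⟨ sym (++-assoc A B (m ∷ [])) ⟩
    (A ++ B) ++ m ∷ []    ≡⟨ cong (_++ m ∷ []) AB≡I ⟩
    proj₁ (splitLast x xs) ++ m ∷ [] ≡⟨ sym (splitLast-cut x xs) ⟩
    x ∷ xs ∎
  where
  open ≡-Reasoning
  m : ℕ
  m = proj₂ (splitLast x xs)
  sL≡A : s L ≡ A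
  sL≡A = preimages-sound k A L L∈
  sR≡B : s R ≡ B
  sR≡B = preimages-sound k B R R∈
  AB<m : All (_< m) (A ++ B)
  AB<m = subst (All (_< m)) (sym AB≡I) I<m
  L<m : All (_< m) L
  L<m = below-s⁻ L (subst (All (_< m)) (sym sL≡A) (AllP.++⁻ˡ A AB<m))
  R<m : All (_< m) R
  R<m = below-s⁻ R (subst (All (_< m)) (sym sR≡B) (AllP.++⁻ʳ A AB<m))

preimages-complete : ∀ a τ → Unique τ → length τ < a → τ ∈ preimages a (s τ)
glued-complete : ∀ k L m R → All (_< m) L → All (_< m) R → Unique (L ++ m ∷ R) →
  length (L ++ m ∷ R) < suc k → L ++ m ∷ R ∈ preimages (suc k) (s (L ++ m ∷ R))

preimages-complete (suc k) [] _ _ = here refl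
preimages-complete (suc k) (x ∷ xs) u τ<a with max-decomposition x xs u
... | m , L , R , cut , L<m , R<m =
  subst (λ τ → τ ∈ preimages (suc k) (s τ)) (sym cut)
        (glued-complete k L m R L<m R<m (subst Unique cut u) (subst (λ τ → length τ < suc k) cut τ<a))

glued-complete k L m R L<m R<m u τ<a =
  subst (L ++ m ∷ R ∈_) (cong (preimages (suc k)) s-glued)
    (subst (L ++ m ∷ R ∈_) (sym (trans (preimages-snoc k (s L ++ s R) m)
                                       (preimagesEnding-below k (s L ++ s R) m sLR<m)))
      (∈-concatCuts⁺ (λ A B → glue m (preimages k A) (preimages k B)) (s L) (s R)
        (∈-glue⁺ m (preimages-complete k L (proj₁ (unique-around L u)) (proj₁ (around-shorter L m R τ<a)))
                   (preimages-complete k R (proj₂ (unique-around L u)) (proj₂ (around-shorter L m R τ<a))))))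
  where
  s-glued : (s L ++ s R) ++ m ∷ [] ≡ s (L ++ m ∷ R)
  s-glued = trans (++-assoc (s L) (s R) (m ∷ [])) (sym (s-split m L R L<m R<m))
  sLR<m : All (_< m) (s L ++ s R)
  sLR<m = AllP.++⁺ (below-s L L<m) (below-s R R<m)

preimages-unique : ∀ a σ → Unique σ → Unique (preimages a σ)
preimages-unique zero σ _ = []
preimages-unique (suc k) [] _ = [] ∷ []
preimages-unique (suc k) (x ∷ xs) u with all? (_<? proj₂ (splitLast x xs)) (proj₁ (splitLast x xs))
... | no _ = []
... | yes I<m = unique-concatCuts _ I
      (λ A B e → unique-glue m (preimages k A) (preimages k B)
                   (preimages-unique k A (unique-++ˡ A (subst Unique (sym e) uI)))
                   (preimages-unique k B (unique-++ʳ A (subst Unique (sym e) uI)))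
                   (m∉ A B e))
      same-cut
  where
  I : List ℕ
  I = proj₁ (splitLast x xs)
  m : ℕ
  m = proj₂ (splitLast x xs)
  uI : Unique I
  uI = unique-++ˡ I (subst Unique (splitLast-cut x xs) u)
  m∉ : ∀ A B → A ++ B ≡ I → ∀ {L} → L ∈ preimages k A → m ∉ L
  m∉ A B e {L} L∈ = below⇒∉ L (below-s⁻ L (subst (All (_< m)) (sym (preimages-sound k A L L∈))
                                                   (AllP.++⁻ˡ A (subst (All (_< m)) (sym e) I<m))))
  -- A glued preimage L ++ m ∷ R determines L, hence the cut A = s L.
  same-cut : ∀ {A B A′ B′ τ} → A ++ B ≡ I → A′ ++ B′ ≡ I →
    τ ∈ glue m (preimages k A) (preimages k B) → τ ∈ glue m (preimages k A′) (preimages k B′) →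
    length A ≡ length A′
  same-cut {A} {B} {A′} {B′} e e′ τ∈ τ∈′
    with ∈-glue⁻ m (preimages k A) (preimages k B) τ∈ | ∈-glue⁻ m (preimages k A′) (preimages k B′) τ∈′
  ... | L , _ , L∈ , _ , τ≡ | L′ , _ , L′∈ , _ , τ≡′
    with cut-unique L L′ (m∉ A B e L∈) (m∉ A′ B′ e′ L′∈) (trans (sym τ≡) τ≡′)
  ... | refl , _ = cong length (trans (sym (preimages-sound k A L L∈)) (preimages-sound k A′ L L′∈))

∈-insertions⁻ : ∀ x t {τ} → τ ∈ insertions x t → ∃₂ λ P Q → t ≡ P ++ Q × τ ≡ P ++ x ∷ Q
∈-insertions⁻ x [] (here refl) = [] , [] , refl , refl
∈-insertions⁻ x (y ∷ ys) (here refl) = [] , y ∷ ys , refl , refl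
∈-insertions⁻ x (y ∷ ys) (there τ∈) with ∈-map⁻ (y ∷_) τ∈
... | _ , τ′∈ , refl with ∈-insertions⁻ x ys τ′∈
...   | P , Q , refl , refl = y ∷ P , Q , refl , refl

∈-insertions⁺ : ∀ x P Q → P ++ x ∷ Q ∈ insertions x (P ++ Q)
∈-insertions⁺ x [] [] = here refl
∈-insertions⁺ x [] (q ∷ Q) = here refl
∈-insertions⁺ x (p ∷ P) Q = there (∈-map⁺ (p ∷_) (∈-insertions⁺ x P Q))

unique-insertions : ∀ x t → x ∉ t → Unique (insertions x t)
unique-insertions x [] _ = [] ∷ []
unique-insertions x (y ∷ ys) x∉ =
  All.tabulate (λ τ∈ → not-head (∈-map⁻ (y ∷_) τ∈))
    ∷ Unique.map⁺ ∷-injectiveʳ (unique-insertions x ys (x∉ ∘ there))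
  where
  not-head : ∀ {τ} → (∃ λ τ′ → τ′ ∈ insertions x ys × τ ≡ y ∷ τ′) → x ∷ y ∷ ys ≢ τ
  not-head (_ , _ , refl) e = x∉ (here (proj₁ (∷-injective e)))

∈-perms⁻ : ∀ D {τ} → τ ∈ perms D → τ ↭ D
∈-perms⁻ [] (here refl) = ↭-refl
∈-perms⁻ (x ∷ xs) τ∈ with find (∈-concatMap⁻ (insertions x) {xs = perms xs} τ∈)
... | t , t∈ , τ∈ins with ∈-insertions⁻ x t τ∈ins
...   | P , Q , refl , refl = ↭-trans (shift x P Q) (prep x (∈-perms⁻ xs t∈))

∈-perms⁺ : ∀ D {τ} → τ ↭ D → τ ∈ perms D
∈-perms⁺ [] τ↭ rewrite ↭-empty-inv τ↭ = here refl
∈-perms⁺ (x ∷ xs) τ↭ with ∈-∃++ (∈-resp-↭ (↭-sym τ↭) (here refl))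
... | P , Q , refl = ∈-concatMap⁺ (insertions x) {xs = perms xs}
    (Any.map (λ { refl → ∈-insertions⁺ x P Q }) (∈-perms⁺ xs (drop-mid P [] τ↭)))

unique-perms : ∀ D → Unique D → Unique (perms D)
unique-perms [] _ = [] ∷ []
unique-perms (x ∷ xs) (x∉ ∷ u) = unique-concatMap (insertions x) (perms xs) (unique-perms xs u)
  (λ t∈ → unique-insertions x _ (x∉t t∈)) same-base
  where
  x∉t : ∀ {t} → t ∈ perms xs → x ∉ t
  x∉t t∈ x∈ = All.lookup x∉ (∈-resp-↭ (∈-perms⁻ xs t∈) x∈) refl
  -- Deleting the inserted x recovers the base permutation.
  same-base : ∀ {t t′ τ} → t ∈ perms xs → t′ ∈ perms xs →
    τ ∈ insertions x t → τ ∈ insertions x t′ → t ≡ t′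
  same-base {t} {t′} t∈ t′∈ τ∈ τ∈′ with ∈-insertions⁻ x t τ∈ | ∈-insertions⁻ x t′ τ∈′
  ... | P , Q , refl , e | P′ , Q′ , refl , e′
    with cut-unique P P′ (x∉t t∈ ∘ ∈-++⁺ˡ) (x∉t t′∈ ∘ ∈-++⁺ˡ) (trans (sym e) e′)
  ... | refl , refl = refl

unique-idPerm : ∀ n → Unique (idPerm n)
unique-idPerm n = Unique.map⁺ suc-injective (Unique.upTo⁺ n)

fertility≡fert : ∀ n σ → S n σ → fertility n σ ≡ fert σ
fertility≡fert n σ σ↭ =
  unique-length (Unique.filter⁺ is-preimage? (unique-perms (idPerm n) (unique-idPerm n)))
                (preimages-unique (suc (length σ)) σ (Unique-resp-↭ (↭-sym σ↭) (unique-idPerm n)))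
                enumerated counted
  where
  is-preimage? : ∀ τ → Dec (s τ ≡ σ)
  is-preimage? = λ τ → ≡-dec _≟_ (s τ) σ
  enumerated : ∀ {τ} → τ ∈ filter is-preimage? (perms (idPerm n)) → τ ∈ preimages (suc (length σ)) σ
  enumerated {τ} τ∈ with ∈-filter⁻ is-preimage? {xs = perms (idPerm n)} τ∈
  ... | τ∈perms , refl = preimages-complete (suc (length (s τ))) τ
        (Unique-resp-↭ (↭-sym (∈-perms⁻ (idPerm n) τ∈perms)) (unique-idPerm n))
        (s≤s (≤-reflexive (sym (length-s τ))))
  counted : ∀ {τ} → τ ∈ preimages (suc (length σ)) σ → τ ∈ filter is-preimage? (perms (idPerm n))
  counted {τ} τ∈ = ∈-filter⁺ is-preimage? (∈-perms⁺ (idPerm n) τ↭) sτ≡σ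
    where
    sτ≡σ : s τ ≡ σ
    sτ≡σ = preimages-sound (suc (length σ)) σ τ τ∈
    τ↭ : τ ↭ idPerm n
    τ↭ = ↭-trans (↭-sym (s-↭ τ)) (subst (_↭ idPerm n) (sym sτ≡σ) σ↭)

-- 5. The induction on the maximum decomposition.

open Powers fert refl

-- A word with no repetitions has a preimage of its sorted image: itself.
fert-s-positive : ∀ τ → Unique τ → 1 ≤ fert (s τ)
fert-s-positive τ u =
  ∈-length (preimages-complete (suc (length (s τ))) τ u (s≤s (≤-reflexive (sym (length-s τ)))))

SortingIncreases : List ℕ → Set
SortingIncreases π = (∀ j → F j π ≤ F j (s π)) × (s π ≢ π → ∀ j → F (suc j) π < F (suc j) (s π))

module _ (L : List ℕ) (m : ℕ) (R : List ℕ) (L<m : All (_< m) L) (R<m : All (_< m) R)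
         (ihL : SortingIncreases L) (ihR : SortingIncreases R) where

  open Splitting m (λ I → fert-ending-at I m) (λ I → fert-vanishes I m)

  F-s-cut : ∀ j → F j (s (L ++ m ∷ R)) ≡ cross (s L ++ s R) [] 2 j
  F-s-cut j = begin
    F j (s (L ++ m ∷ R))           ≡⟨ cong (F j) (s-split m L R L<m R<m) ⟩
    F j (s L ++ s R ++ m ∷ [])     ≡⟨ cong (F j) (sym (++-assoc (s L) (s R) (m ∷ []))) ⟩
    F j ((s L ++ s R) ++ m ∷ [])   ≡⟨ F-split j (s L ++ s R) [] (AllP.++⁺ (below-s L L<m) (below-s R R<m)) [] ⟩
    cross (s L ++ s R) [] 2 j ∎
    where open ≡-Reasoning

  -- Sort the two sides (induction hypothesis), then merge them.
  cut-increases : ∀ j → F j (L ++ m ∷ R) ≤ F j (s (L ++ m ∷ R))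
  cut-increases j = begin
    F j (L ++ m ∷ R)           ≡⟨ F-split j L R L<m R<m ⟩
    cross L R 2 j              ≤⟨ cross-mono (proj₁ ihL) (proj₁ ihR) 2 j ⟩
    cross (s L) (s R) 2 j      ≤⟨ cross-merge-≤ (s L) (s R) 2 j ⟩
    cross (s L ++ s R) [] 2 j  ≡⟨ sym (F-s-cut j) ⟩
    F j (s (L ++ m ∷ R)) ∎
    where open ≤-Reasoning

  -- With R empty, s(L m) = s(L) m ≠ L m forces s L ≠ L, and the first
  -- cross term F 2 L grows strictly by the induction hypothesis.
  cut-increases-strictly-[] : R ≡ [] → s (L ++ m ∷ R) ≢ L ++ m ∷ R →
    ∀ j → F (suc j) (L ++ m ∷ R) < F (suc j) (s (L ++ m ∷ R))
  cut-increases-strictly-[] refl s≢ j = begin-strict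
    F (suc j) (L ++ m ∷ [])                      ≡⟨ F-split (suc j) L [] L<m [] ⟩
    F 2 L * F j [] + cross L [] 3 j              <⟨ +-mono-<-≤ first-term (cross-mono (proj₁ ihL) (λ _ → ≤-refl) 3 j) ⟩
    F 2 (s L) * F j [] + cross (s L) [] 3 j      ≡⟨ sym (F-split (suc j) (s L) [] (below-s L L<m) []) ⟩
    F (suc j) (s L ++ m ∷ [])                    ≡⟨ cong (F (suc j)) (sym (s-split m L [] L<m [])) ⟩
    F (suc j) (s (L ++ m ∷ [])) ∎
    where
    open ≤-Reasoning
    sL≢L : s L ≢ L
    sL≢L e = s≢ (trans (s-split m L [] L<m []) (cong (_++ m ∷ []) e))
    first-term : F 2 L * F j [] < F 2 (s L) * F j []
    first-term rewrite F-[] j | *-identityʳ (F 2 L) | *-identityʳ (F 2 (s L)) = proj₂ ihL sL≢L 1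

  -- With R nonempty, the merge is strict: s L and s R both have preimages.
  cut-increases-strictly-∷ : ∀ {r R′} → R ≡ r ∷ R′ → Unique (L ++ m ∷ R) →
    ∀ j → F (suc j) (L ++ m ∷ R) < F (suc j) (s (L ++ m ∷ R))
  cut-increases-strictly-∷ refl u j = begin-strict
    F (suc j) (L ++ m ∷ R)              ≡⟨ F-split (suc j) L R L<m R<m ⟩
    cross L R 2 (suc j)                 ≤⟨ cross-mono (proj₁ ihL) (proj₁ ihR) 2 (suc j) ⟩
    cross (s L) (s R) 2 (suc j)         <⟨ cross-merge-< (s L) (s R) sL-fertile sR-fertile j ⟩
    cross (s L ++ s R) [] 2 (suc j)     ≡⟨ sym (F-s-cut (suc j)) ⟩
    F (suc j) (s (L ++ m ∷ R)) ∎
    where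
    open ≤-Reasoning
    sL-fertile : 1 ≤ fert (s L)
    sL-fertile = fert-s-positive L (proj₁ (unique-around L u))
    sR-fertile : 1 ≤ F⁺ 1 (s R)
    sR-fertile = first-block (s R) (fert-s-positive R (proj₂ (unique-around L u)))
                 (λ e → 0≢1+n (trans (sym (cong length e)) (length-s R)))
      where
      first-block : ∀ Y → 1 ≤ fert Y → Y ≢ [] → 1 ≤ F⁺ 1 Y
      first-block [] _ Y≢[] = ⊥-elim (Y≢[] refl)
      first-block (y ∷ Y) p _ = subst (1 ≤_) (sym (F⁺-one y Y)) p

  cut-increases-all : Unique (L ++ m ∷ R) → SortingIncreases (L ++ m ∷ R)
  cut-increases-all u = cut-increases , strictly R refl
    where
    strictly : ∀ R′ → R ≡ R′ → s (L ++ m ∷ R) ≢ L ++ m ∷ R →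
      ∀ j → F (suc j) (L ++ m ∷ R) < F (suc j) (s (L ++ m ∷ R))
    strictly [] R≡[] s≢ = cut-increases-strictly-[] R≡[] s≢
    strictly (_ ∷ _) R≡ _ = cut-increases-strictly-∷ R≡ u

sorting-increases : ∀ τ → Unique τ → SortingIncreases τ
sorting-increases τ = below (suc (length τ)) τ ≤-refl
  where
  below : ∀ n τ → length τ < n → Unique τ → SortingIncreases τ
  below (suc n) [] _ _ = (λ _ → ≤-refl) , (λ s≢ → ⊥-elim (s≢ refl))
  below (suc n) (x ∷ xs) τ<n u with max-decomposition x xs u
  ... | m , L , R , cut , L<m , R<m =
    subst SortingIncreases (sym cut)
      (cut-increases-all L m R L<m R<m (below n L L<n uL) (below n R R<n uR) u′)
    where
    u′ : Unique (L ++ m ∷ R)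
    u′ = subst Unique cut u
    uL : Unique L
    uL = proj₁ (unique-around L u′)
    uR : Unique R
    uR = proj₂ (unique-around L u′)
    L<n : length L < n
    L<n = proj₁ (around-shorter L m R (subst (λ τ → length τ < suc n) cut τ<n))
    R<n : length R < n
    R<n = proj₂ (around-shorter L m R (subst (λ τ → length τ < suc n) cut τ<n))

-- 6. The identity is the only permutation fixed by s.

idPerm-snoc : ∀ n → idPerm (suc n) ≡ idPerm n ++ suc n ∷ []
idPerm-snoc n = trans (cong (map suc) (sym (upTo-∷ʳ n))) (map-++ suc (upTo n) (n ∷ []))

idPerm-≤ : ∀ n {y} → y ∈ idPerm n → y ≤ n
idPerm-≤ n y∈ with ∈-map⁻ suc y∈
... | _ , z∈ , refl = ∈-upTo⁻ z∈

s-idPerm : ∀ n → s (idPerm n) ≡ idPerm n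
s-idPerm zero = refl
s-idPerm (suc n) = begin
  s (idPerm (suc n))               ≡⟨ cong s (idPerm-snoc n) ⟩
  s (idPerm n ++ suc n ∷ [])       ≡⟨ s-split (suc n) (idPerm n) [] (All.tabulate (s≤s ∘ idPerm-≤ n)) [] ⟩
  s (idPerm n) ++ suc n ∷ []       ≡⟨ cong (_++ suc n ∷ []) (s-idPerm n) ⟩
  idPerm n ++ suc n ∷ []           ≡⟨ sym (idPerm-snoc n) ⟩
  idPerm (suc n) ∎
  where open ≡-Reasoning

-- s(L m R) ends in m, so it differs from L m R when R is nonempty and below m.
s-moves-right-part : ∀ m L r R → All (_< m) L → All (_< m) (r ∷ R) → s (L ++ m ∷ r ∷ R) ≢ L ++ m ∷ r ∷ R
s-moves-right-part m L r R L<m rR<m fixed = <-irrefl last≡m (All.lookup rR<m last∈)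
  where
  I : List ℕ
  I = proj₁ (splitLast r R)
  last : ℕ
  last = proj₂ (splitLast r R)
  last∈ : last ∈ r ∷ R
  last∈ = subst (last ∈_) (sym (splitLast-cut r R)) (∈-++⁺ʳ I (here refl))
  ends-in-last : L ++ m ∷ r ∷ R ≡ (L ++ m ∷ I) ++ last ∷ []
  ends-in-last = trans (cong (λ t → L ++ m ∷ t) (splitLast-cut r R)) (sym (++-assoc L (m ∷ I) (last ∷ [])))
  ends-in-m : s (L ++ m ∷ r ∷ R) ≡ (s L ++ s (r ∷ R)) ++ m ∷ []
  ends-in-m = trans (s-split m L (r ∷ R) L<m rR<m) (sym (++-assoc (s L) (s (r ∷ R)) (m ∷ [])))
  last≡m : last ≡ m
  last≡m = sym (proj₂ (∷ʳ-injective _ _ (trans (sym ends-in-m) (trans fixed ends-in-last))))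

max-of-idPerm : ∀ n L m → All (_< m) L → L ++ m ∷ [] ↭ idPerm (suc n) → m ≡ suc n × L ↭ idPerm n
max-of-idPerm n L m L<m Lm↭ = m≡suc-n , L↭
  where
  Lm↭′ : L ++ m ∷ [] ↭ idPerm n ++ suc n ∷ []
  Lm↭′ = subst (L ++ m ∷ [] ↭_) (idPerm-snoc n) Lm↭
  m≤suc-n : m ≤ suc n
  m≤suc-n = idPerm-≤ (suc n) (∈-resp-↭ Lm↭ (∈-++⁺ʳ L (here refl)))
  m≡suc-n : m ≡ suc n
  m≡suc-n with ∈-++⁻ L (∈-resp-↭ (↭-sym Lm↭′) (∈-++⁺ʳ (idPerm n) (here refl)))
  ... | inj₁ suc-n∈L = ⊥-elim (<⇒≱ (All.lookup L<m suc-n∈L) m≤suc-n)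
  ... | inj₂ (here suc-n≡m) = sym suc-n≡m
  L↭ : L ↭ idPerm n
  L↭ = subst₂ _↭_ (++-identityʳ L) (++-identityʳ (idPerm n))
         (drop-mid L (idPerm n) (subst (λ μ → L ++ μ ∷ [] ↭ idPerm n ++ suc n ∷ []) m≡suc-n Lm↭′))

-- A fixed point L m R of s has R empty; then s L ≡ L and m = n + 1, and
-- induction on n applies to L.
s-fixed⇒idPerm : ∀ n σ → S n σ → s σ ≡ σ → σ ≡ idPerm n
s-fixed⇒idPerm zero σ σ↭ _ = ↭-empty-inv σ↭
s-fixed⇒idPerm (suc n) [] σ↭ _ =
  ⊥-elim (0≢1+n (trans (↭-length σ↭) (trans (length-map suc (upTo (suc n))) (length-upTo (suc n)))))
s-fixed⇒idPerm (suc n) (x ∷ xs) σ↭ fixed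
  with max-decomposition x xs (Unique-resp-↭ (↭-sym σ↭) (unique-idPerm (suc n)))
... | m , L , r ∷ R , cut , L<m , rR<m =
  ⊥-elim (s-moves-right-part m L r R L<m rR<m (trans (cong s (sym cut)) (trans fixed cut)))
... | m , L , [] , cut , L<m , [] = begin
    x ∷ xs                 ≡⟨ cut ⟩
    L ++ m ∷ []            ≡⟨ cong₂ (λ A μ → A ++ μ ∷ []) L≡idPerm m≡suc-n ⟩
    idPerm n ++ suc n ∷ [] ≡⟨ sym (idPerm-snoc n) ⟩
    idPerm (suc n) ∎
  where
  open ≡-Reasoning
  m≡suc-n : m ≡ suc n
  m≡suc-n = proj₁ (max-of-idPerm n L m L<m (subst (_↭ idPerm (suc n)) cut σ↭))
  L↭ : L ↭ idPerm n
  L↭ = proj₂ (max-of-idPerm n L m L<m (subst (_↭ idPerm (suc n)) cut σ↭))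
  sL≡L : s L ≡ L
  sL≡L = proj₁ (∷ʳ-injective (s L) L (trans (sym (s-split m L [] L<m [])) (trans (cong s (sym cut)) (trans fixed cut))))
  L≡idPerm : L ≡ idPerm n
  L≡idPerm = s-fixed⇒idPerm n L L↭ sL≡L

fertility≡F₁ : ∀ n π → S n π → fertility n π ≡ F 1 π
fertility≡F₁ n π π↭ = trans (fertility≡fert n π π↭) (sym (F-one π))

module _ (n : ℕ) (σ : List ℕ) (σ↭ : S n σ) where

  private
    increases : SortingIncreases σ
    increases = sorting-increases σ (Unique-resp-↭ (↭-sym σ↭) (unique-idPerm n))

    sσ↭ : S n (s σ)
    sσ↭ = ↭-trans (s-↭ σ) σ↭

  fertility-increases : fertility n σ ≤ fertility n (s σ)
  fertility-increases =
    subst₂ _≤_ (sym (fertility≡F₁ n σ σ↭)) (sym (fertility≡F₁ n (s σ) sσ↭)) (proj₁ increases 1)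

  fertility-increases-strictly : s σ ≢ σ → fertility n σ < fertility n (s σ)
  fertility-increases-strictly moved =
    subst₂ _<_ (sym (fertility≡F₁ n σ σ↭)) (sym (fertility≡F₁ n (s σ) sσ↭)) (proj₂ increases moved 0)

theorem1p2 : (n : ℕ) (σ : List ℕ) → S n σ →
             (fertility n σ ≤ fertility n (s σ))
             × ((fertility n σ ≡ fertility n (s σ)) ⇔ (σ ≡ idPerm n))
theorem1p2 n σ σ↭ = fertility-increases n σ σ↭ , mk⇔ equal⇒idPerm idPerm⇒equal
  where
  equal⇒idPerm : fertility n σ ≡ fertility n (s σ) → σ ≡ idPerm n
  equal⇒idPerm eq with ≡-dec _≟_ (s σ) σ
  ... | yes fixed = s-fixed⇒idPerm n σ σ↭ fixed
  ... | no moved = ⊥-elim (<-irrefl eq (fertility-increases-strictly n σ σ↭ moved))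
  idPerm⇒equal : σ ≡ idPerm n → fertility n σ ≡ fertility n (s σ)
  idPerm⇒equal refl = cong (fertility n) (sym (s-idPerm n))
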